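{- If $I = (1,0,0)$, then $L(n,I) \geq \frac{2^{n-1}}{n}$ for every $n \in \mathbb{N}$.
   Context: For $n \in \mathbb{N}$ and $I=(I_1,I_2,I_3) \in \{0,1\}^3$, $M_I^{(n)}$ is the tournament on $\{x_1,\ldots,x_{2n}\} \cup \{y_1,\ldots,y_n\}$ with: (i) $x_i \to x_j$ for $i<j$; (ii) $x_{2i} \to y_i \to x_{2i-1}$ for each $i \in [n]$; (iii) for $i<j$, $y_i \to y_j$ iff $I_1=1$; (iv) for $i \le 2j-2$, $x_i \to y_j$ iff $I_2 = 1$; (v) for $i \ge 2j+1$, $y_j \to x_i$ iff $I_3 = 1$. $L(n,I)$ is the number of pairwise non-isomorphic $n$-vertex tournaments that are isomorphic to an induced sub-tournament of $M_I^{(m)}$ for some (equivalently all sufficiently large) $m$. -}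

module Defs where

open import Data.Nat using (ℕ; _+_; _*_; _<_; _<?_)
open import Data.Nat.Properties using (_≟_)
open import Data.Bool using (Bool; true; false; not; if_then_else_)
open import Data.Fin using (Fin; toℕ)
open import Data.Fin.Permutation using (Permutation′; _⟨$⟩ʳ_)
open import Data.Product using (_×_; Σ; ∃-syntax)
open import Function.Definitions using (Injective)
open import Relation.Nullary using (does; ¬_)
open import Relation.Binary.PropositionalEquality using (_≡_)

-- A tournament on the vertex set Fin n, given by its arc relation
-- (adj u v ≡ true  means  u → v).
record Tournament (n : ℕ) : Set where
  field
    adj         : Fin n → Fin n → Bool
    irreflexive : ∀ u → adj u u ≡ false
    tournament  : ∀ u v → ¬ (u ≡ v) → adj u v ≡ not (adj v u)
open Tournament public

Iso : {n : ℕ} → Tournament n → Tournament n → Set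
Iso {n} S T = Σ (Permutation′ n) λ π →
  ∀ u v → adj T (π ⟨$⟩ʳ u) (π ⟨$⟩ʳ v) ≡ adj S u v

Param : Set
Param = Bool × Bool × Bool

-- Vertices of M_I^(m):  X a  is x_{a+1} (a < 2m),  Y b  is y_{b+1} (b < m).
data V (m : ℕ) : Set where
  X : Fin (m + m) → V m
  Y : Fin m → V m

-- Whether x_{a+1} → y_{b+1} (0-based indices a, b).
--   a < 2b       (i ≤ 2j-2) : x → y  iff I₂
--   a = 2b       (i = 2j-1) : y → x
--   a = 2b+1     (i = 2j)   : x → y
--   a > 2b+1     (i ≥ 2j+1) : y → x  iff I₃
xToY : Param → ℕ → ℕ → Bool
xToY (I₁ Data.Product., I₂ Data.Product., I₃) a b =
  if does (a <? 2 * b) then I₂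
  else if does (a ≟ 2 * b) then false
  else if does (a ≟ 2 * b + 1) then true
  else not I₃

arc : {m : ℕ} → Param → V m → V m → Bool
arc I (X a) (X a′) = does (toℕ a <? toℕ a′)
arc I (X a) (Y b)  = xToY I (toℕ a) (toℕ b)
arc I (Y b) (X a)  = not (xToY I (toℕ a) (toℕ b))
arc (I₁ Data.Product., _) (Y b) (Y c) =
  if does (toℕ b <? toℕ c) then I₁
  else if does (toℕ c <? toℕ b) then not I₁
  else false

EmbedsIn : {n : ℕ} → Param → ℕ → Tournament n → Set
EmbedsIn {n} I m T = Σ (Fin n → V m) λ g →
  Injective _≡_ _≡_ g × (∀ u v → arc I (g u) (g v) ≡ adj T u v)

Realizable : {n : ℕ} → Param → Tournament n → Set
Realizable I T = ∃[ m ] EmbedsIn I m T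

I100 : Param
I100 = true Data.Product., false Data.Product., false

-- For c : Fin n → Bool let T_c be the transitive tournament with every arc between c⁻¹(true)
-- and c⁻¹(false) reversed. Each T_c embeds in M_(1,0,0), by sending i to x_{2i+1} or to y_{i+1}
-- according to c i.
--
-- From a vertex u of T_c one reads off a word: switching T_c at the out-neighbourhood of u makes
-- it transitive with u first, and the word records, position by position, which vertices beat u.
-- The reading is an isomorphism invariant; at vertex 0 it returns c (when c 0 = false), and at
-- any u it returns a word c′ with T_c′ ≅ T_c via the cyclic rotation x ↦ u + x mod n.
--
-- Choose in every isomorphism class the minimal code of a reading. A word c with c 0 = false is
-- then determined by the class of T_c together with a vertex where the minimum is attained, so the
-- 2^(n-1) such words lie in at least 2^(n-1)/n classes.

module Submission where

open import Defs
open import Data.Bool using (Bool; true; false; not; _xor_; _∧_; if_then_else_)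
open import Data.Bool.Properties using (xor-same; xor-comm; xor-identityʳ; true-xor; not-distribˡ-xor; if-eta)
open import Data.Bool.Solver using (module xor-∧-Solver)
open import Data.Empty using (⊥-elim)
open import Data.Fin using (Fin; zero; suc; toℕ; fromℕ<; combine; funToFin; finToFun) renaming (_≤_ to _≤ᶠ_)
open import Data.Fin.Permutation using (Permutation′; _⟨$⟩ʳ_; _⟨$⟩ˡ_; inverseʳ; permutation; flip)
open import Data.Fin.Properties
  using (_≟_; 2↔Bool; funToFin-finToFin; finToFun-funToFin; toℕ<n; toℕ-fromℕ<; toℕ-injective)
import Data.Fin.Properties as Finₚ
import Data.List.Extrema as Extrema
open import Data.List using (List; _∷_; allFin; filter; length; lookup)
open import Data.List.Membership.Propositional using (_∈_)
open import Data.List.Membership.Propositional.Properties using (∈-allFin; ∈-lookup; ∈-filter⁺; ∈-filter⁻)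
import Data.List.Relation.Unary.All as All
open import Data.List.Relation.Unary.AllPairs using (_∷_)
import Data.List.Relation.Unary.Any as Any
import Data.List.Relation.Unary.Any.Properties as AnyP
open import Data.List.Relation.Unary.Unique.Propositional using (Unique)
import Data.List.Relation.Unary.Unique.Propositional.Properties as Uniqueₚ
open import Data.Nat using (ℕ; zero; suc; _+_; _*_; _^_; _∸_; _≤_; _<_; _<?_; _≤?_; _≡ᵇ_; _<ᵇ_; s≤s)
open import Data.Nat.Properties
  using ( +-0-commutativeMonoid; <-cmp; <-irrefl; <⇒≤; <⇒≱; <⇒≯; ≮⇒≥; ≰⇒>; ≤⇒≯; <-≤-trans; m≤m+n
        ; +-assoc; +-comm; +-identityʳ; +-monoʳ-<; +-monoʳ-≤; +-cancelˡ-<; +-cancelʳ-<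
        ; *-comm; *-monoʳ-<; *-monoʳ-≤; *-cancelˡ-≡
        ; ∸-monoˡ-<; ∸-monoˡ-≤; +-∸-assoc; m∸n≤m; m∸n+n≡m; m+n∸m≡n; m+[n∸m]≡n )
  renaming (_≟_ to _≟ℕ_)
open import Algebra.Properties.CommutativeMonoid.Sum +-0-commutativeMonoid using (sum; sum-cong-≗; sum-permute)
open import Data.Product using (_×_; _,_; Σ; ∃-syntax; proj₁; proj₂)
open import Function using (_∘_; mk⇔; Injection; Inverse)
open import Function.Definitions using (Injective)
open import Function.Properties.Inverse using (↔⇒↣)
open import Relation.Binary.Definitions using (tri<; tri≈; tri>)
open import Relation.Binary.PropositionalEquality
open import Relation.Nullary using (¬_; Dec; does; yes; no)
open import Relation.Nullary.Decidable using (dec-true; dec-false; does-⇔; decidable-stable)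
open import Relation.Unary using (Decidable)

count : ∀ {n} → (Fin n → Bool) → ℕ
count f = sum (λ i → if f i then 1 else 0)

count-cong : ∀ {n} {f g : Fin n → Bool} → (∀ i → f i ≡ g i) → count f ≡ count g
count-cong f≗g = sum-cong-≗ (λ i → cong (λ b → if b then 1 else 0) (f≗g i))

count-permute : ∀ {n} (f : Fin n → Bool) (π : Permutation′ n) → count f ≡ count (f ∘ (π ⟨$⟩ʳ_))
count-permute f = sum-permute (λ i → if f i then 1 else 0)

count-false : ∀ {n} → count {n} (λ _ → false) ≡ 0
count-false {zero}  = refl
count-false {suc n} = count-false {n}

count-<? : ∀ {n} k → k ≤ n → count {n} (λ x → does (toℕ x <? k)) ≡ k
count-<? {zero}  zero    _         = refl
count-<? {suc n} zero    _         = count-false {n}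
count-<? {suc n} (suc k) (s≤s k≤n) = cong suc (count-<? {n} k k≤n)

count-single : ∀ {n} (i : Fin n) (g : Fin n → Bool) →
  count (λ v → (toℕ v ≡ᵇ toℕ i) ∧ g v) ≡ (if g i then 1 else 0)
count-single {suc n} zero    g = trans (cong ((if g zero then 1 else 0) +_) (count-false {n})) (+-identityʳ _)
count-single {suc n} (suc i) g = count-single i (g ∘ suc)

does-<?-cong : ∀ {a b c d} → (a < b → c < d) → (b ≤ a → d ≤ c) → does (a <? b) ≡ does (c <? d)
does-<?-cong {a} {b} {c} {d} <⇒< ≥⇒≥ = does-⇔ (mk⇔ <⇒< reflect) (a <? b) (c <? d)
  where
  reflect : c < d → a < b
  reflect c<d = decidable-stable (a <? b) (λ a≮b → ≤⇒≯ (≥⇒≥ (≮⇒≥ a≮b)) c<d)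

xor-trueʳ : ∀ x → x xor true ≡ not x
xor-trueʳ x = trans (xor-comm x true) (true-xor x)

-- Switched transitive tournaments and their realisation in M_(1,0,0)

ascending : ∀ {n} → Fin n → Fin n → Bool
ascending i j = does (toℕ i <? toℕ j)

ascending-irrefl : ∀ {n} (i : Fin n) → ascending i i ≡ false
ascending-irrefl i = dec-false (toℕ i <? toℕ i) (<-irrefl refl)

ascending-antisym : ∀ {n} {i j : Fin n} → ¬ i ≡ j → ascending i j ≡ not (ascending j i)
ascending-antisym {i = i} {j} i≢j with <-cmp (toℕ i) (toℕ j)
... | tri< i<j _ j≮i = trans (dec-true (_ <? _) i<j) (cong not (sym (dec-false (_ <? _) j≮i)))
... | tri≈ _ i≡j _   = ⊥-elim (i≢j (toℕ-injective i≡j))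
... | tri> i≮j _ j<i = trans (dec-false (_ <? _) i≮j) (cong not (sym (dec-true (_ <? _) j<i)))

switch : ∀ {n} → (Fin n → Fin n → Bool) → (Fin n → Bool) → Fin n → Fin n → Bool
switch r c i j = r i j xor (c i xor c j)

switchedTransitive : ∀ {n} → (Fin n → Bool) → Tournament n
switchedTransitive c = record
  { adj         = switch ascending c
  ; irreflexive = λ u → cong₂ _xor_ (ascending-irrefl u) (xor-same (c u))
  ; tournament  = λ u v u≢v → begin
      ascending u v xor (c u xor c v)        ≡⟨ cong₂ _xor_ (ascending-antisym u≢v) (xor-comm (c u) (c v)) ⟩
      not (ascending v u) xor (c v xor c u)  ≡⟨ not-distribˡ-xor (ascending v u) _ ⟨
      not (ascending v u xor (c v xor c u))  ∎
  }
  where open ≡-Reasoning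

switchedTransitive-cong : ∀ {n} {c d : Fin n → Bool} → (∀ i → c i ≡ d i) →
  ∀ x y → adj (switchedTransitive c) x y ≡ adj (switchedTransitive d) x y
switchedTransitive-cong c≗d x y = cong₂ (λ a b → ascending x y xor (a xor b)) (c≗d x) (c≗d y)

double : ∀ {n} → Fin n → Fin (n + n)
double {n} i = fromℕ< (subst (2 * toℕ i <_) (cong (n +_) (+-identityʳ n)) (*-monoʳ-< 2 (toℕ<n i)))

toℕ-double : ∀ {n} (i : Fin n) → toℕ (double i) ≡ 2 * toℕ i
toℕ-double i = toℕ-fromℕ< _

place : ∀ {n} → Bool → Fin n → V n
place false i = X (double i)
place true  i = Y i

place-injective : ∀ {n} {b b′} {i j : Fin n} → place b i ≡ place b′ j → i ≡ j
place-injective {b = false} {false} {i} {j} eq =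
  toℕ-injective (*-cancelˡ-≡ (toℕ i) (toℕ j) 2 (begin
    2 * toℕ i       ≡⟨ toℕ-double i ⟨
    toℕ (double i)  ≡⟨ cong (λ { (X a) → toℕ a ; (Y _) → 0 }) eq ⟩
    toℕ (double j)  ≡⟨ toℕ-double j ⟩
    2 * toℕ j       ∎))
  where open ≡-Reasoning
place-injective {b = true}  {true}  refl = refl
place-injective {b = false} {true}  ()
place-injective {b = true}  {false} ()

does-<?-double : ∀ a b → does (2 * a <? 2 * b) ≡ does (a <? b)
does-<?-double a b = sym (does-<?-cong {a} {b} (*-monoʳ-< 2) (*-monoʳ-≤ 2))

xToY-double : ∀ a b → xToY I100 (2 * a) b ≡ does (b <? a)
xToY-double a b with <-cmp b a
... | tri< b<a _ _
  rewrite dec-false (2 * a <? 2 * b) (<⇒≯ (*-monoʳ-< 2 b<a))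
        | dec-false (2 * a ≟ℕ 2 * b) (λ eq → <-irrefl (sym eq) (*-monoʳ-< 2 b<a))
        | dec-true (b <? a) b<a = if-eta _
... | tri≈ _ refl _
  rewrite dec-false (2 * a <? 2 * a) (<-irrefl refl)
        | dec-true (2 * a ≟ℕ 2 * a) refl
        | dec-false (a <? a) (<-irrefl refl) = refl
... | tri> b≮a _ a<b
  rewrite dec-true (2 * a <? 2 * b) (*-monoʳ-< 2 a<b)
        | dec-false (b <? a) b≮a = refl

-- The hypothesis excludes the pair x_{2i+1}, y_{i+1}, whose arc points against the formula.
arc-place : ∀ {n} {b b′} (i j : Fin n) → (i ≡ j → b ≡ b′) →
  arc I100 (place b i) (place b′ j) ≡ ascending i j xor (b xor b′)
arc-place {b = false} {false} i j _ rewrite toℕ-double i | toℕ-double j =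
  trans (does-<?-double (toℕ i) (toℕ j)) (sym (xor-identityʳ _))
arc-place {b = true} {true} i j _ = arc-YY (ascending i j) (ascending j i)
  where
  arc-YY : ∀ l l′ → (if l then true else if l′ then false else false) ≡ l xor false
  arc-YY true  _  = refl
  arc-YY false l′ = if-eta l′
arc-place {b = false} {true} i j i≡j⇒f≡t rewrite toℕ-double i | xToY-double (toℕ i) (toℕ j) =
  trans (ascending-antisym (λ j≡i → false≢true (i≡j⇒f≡t (sym j≡i)))) (sym (xor-trueʳ _))
  where
  false≢true : ¬ false ≡ true
  false≢true ()
arc-place {b = true} {false} i j _ rewrite toℕ-double j | xToY-double (toℕ j) (toℕ i) = sym (xor-trueʳ _)

switchedTransitive-realizable : ∀ {n} (c : Fin n → Bool) → Realizable I100 (switchedTransitive c)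
switchedTransitive-realizable {n} c =
  n , (λ i → place (c i) i) , place-injective , λ i j → arc-place i j (cong c)

-- Reading a word at a vertex

-- Switching T at sourceSwitch T u makes u a source; relativeOrder T u x v says whether x
-- precedes v afterwards. When T is a switched transitive tournament this is a linear order
-- starting at u, rank is the position in it, and wordAt T u i says whether the vertex in
-- position i beats u.
sourceSwitch : ∀ {n} → Tournament n → Fin n → Fin n → Bool
sourceSwitch T u x = adj T u x xor does (x ≟ u)

relativeOrder : ∀ {n} → Tournament n → Fin n → Fin n → Fin n → Bool
relativeOrder T u = switch (adj T) (sourceSwitch T u)

rank : ∀ {n} → Tournament n → Fin n → Fin n → ℕ
rank T u v = count (λ x → relativeOrder T u x v)

wordAt : ∀ {n} → Tournament n → Fin n → Fin n → Bool
wordAt T u i = 0 <ᵇ count (λ v → (rank T u v ≡ᵇ toℕ i) ∧ adj T v u)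

module _ {n} (S T : Tournament n) (π : Permutation′ n)
         (π-hom : ∀ u v → adj T (π ⟨$⟩ʳ u) (π ⟨$⟩ʳ v) ≡ adj S u v) where

  private
    does-π≟π : ∀ x u → does ((π ⟨$⟩ʳ x) ≟ (π ⟨$⟩ʳ u)) ≡ does (x ≟ u)
    does-π≟π x u =
      does-⇔ (mk⇔ (Injection.injective (↔⇒↣ π)) (cong (π ⟨$⟩ʳ_))) ((π ⟨$⟩ʳ x) ≟ (π ⟨$⟩ʳ u)) (x ≟ u)

    relativeOrder-iso : ∀ u x v →
      relativeOrder T (π ⟨$⟩ʳ u) (π ⟨$⟩ʳ x) (π ⟨$⟩ʳ v) ≡ relativeOrder S u x v
    relativeOrder-iso u x v rewrite π-hom x v | π-hom u x | π-hom u v | does-π≟π x u | does-π≟π v u = refl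

    rank-iso : ∀ u v → rank T (π ⟨$⟩ʳ u) (π ⟨$⟩ʳ v) ≡ rank S u v
    rank-iso u v = trans (count-permute _ π) (count-cong (λ x → relativeOrder-iso u x v))

  wordAt-iso : ∀ u i → wordAt T (π ⟨$⟩ʳ u) i ≡ wordAt S u i
  wordAt-iso u i = cong (0 <ᵇ_) (trans (count-permute _ π) (count-cong λ v →
    cong₂ (λ r a → (r ≡ᵇ toℕ i) ∧ a) (rank-iso u v) (π-hom v u)))

ascending-zero : ∀ {m} (x : Fin (suc m)) → ascending zero x xor does (x ≟ zero) ≡ true
ascending-zero zero    = refl
ascending-zero (suc x) = refl

-- Together the two switchings amount to switching by the constant not (c zero), which changes nothing.
relativeOrder-zero : ∀ {m} (c : Fin (suc m) → Bool) x v →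
  relativeOrder (switchedTransitive c) zero x v ≡ ascending x v
relativeOrder-zero c x v = begin
  relativeOrder (switchedTransitive c) zero x v
    ≡⟨ solve 8 (λ l cx cv c₀ a₀x a₀v ex ev →
         (l :+ (cx :+ cv)) :+ (((a₀x :+ (c₀ :+ cx)) :+ ex) :+ ((a₀v :+ (c₀ :+ cv)) :+ ev))
         := l :+ ((a₀x :+ ex) :+ (a₀v :+ ev)))
         refl (ascending x v) (c x) (c v) (c zero) (ascending zero x) (ascending zero v)
              (does (x ≟ zero)) (does (v ≟ zero)) ⟩
  ascending x v xor ((ascending zero x xor does (x ≟ zero)) xor (ascending zero v xor does (v ≟ zero)))
    ≡⟨ cong (ascending x v xor_) (cong₂ _xor_ (ascending-zero x) (ascending-zero v)) ⟩
  ascending x v xor false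
    ≡⟨ xor-identityʳ _ ⟩
  ascending x v ∎
  where open ≡-Reasoning
        open xor-∧-Solver

rank-zero : ∀ {m} (c : Fin (suc m) → Bool) v → rank (switchedTransitive c) zero v ≡ toℕ v
rank-zero c v = trans (count-cong (λ x → relativeOrder-zero c x v)) (count-<? (toℕ v) (<⇒≤ (toℕ<n v)))

wordAt-zero : ∀ {m} (c : Fin (suc m) → Bool) → c zero ≡ false →
  ∀ i → wordAt (switchedTransitive c) zero i ≡ c i
wordAt-zero c c₀≡f i = begin
  0 <ᵇ count (λ v → (rank (switchedTransitive c) zero v ≡ᵇ toℕ i) ∧ adj (switchedTransitive c) v zero)
    ≡⟨ cong (0 <ᵇ_) (count-cong λ v →
         cong (λ r → (r ≡ᵇ toℕ i) ∧ adj (switchedTransitive c) v zero) (rank-zero c v)) ⟩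
  0 <ᵇ count (λ v → (toℕ v ≡ᵇ toℕ i) ∧ adj (switchedTransitive c) v zero)
    ≡⟨ cong (0 <ᵇ_) (count-single i (λ v → adj (switchedTransitive c) v zero)) ⟩
  0 <ᵇ (if c i xor c zero then 1 else 0)
    ≡⟨ positive-indicator (c i xor c zero) ⟩
  c i xor c zero
    ≡⟨ cong (c i xor_) c₀≡f ⟩
  c i xor false
    ≡⟨ xor-identityʳ (c i) ⟩
  c i ∎
  where
  open ≡-Reasoning
  positive-indicator : ∀ b → (0 <ᵇ (if b then 1 else 0)) ≡ b
  positive-indicator true  = refl
  positive-indicator false = refl

-- Cyclic rotations

wraps : ℕ → ℕ → ℕ → Bool
wraps n a x = does (n ≤? a + x)

shift : ℕ → ℕ → ℕ → ℕ
shift n a x = if wraps n a x then a + x ∸ n else a + x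

shift-no-wrap : ∀ {n a x} → a + x < n → shift n a x ≡ a + x
shift-no-wrap {n} {a} {x} a+x<n =
  cong (λ w → if w then a + x ∸ n else a + x) (dec-false (n ≤? a + x) (<⇒≱ a+x<n))

shift-wrap : ∀ {n a x} → n ≤ a + x → shift n a x ≡ a + x ∸ n
shift-wrap {n} {a} {x} n≤a+x =
  cong (λ w → if w then a + x ∸ n else a + x) (dec-true (n ≤? a + x) n≤a+x)

wrapped-< : ∀ {n a x} → x < n → n ≤ a + x → a + x ∸ n < a
wrapped-< {n} {a} {x} x<n n≤a+x =
  +-cancelʳ-< n (a + x ∸ n) a (subst (_< a + n) (sym (m∸n+n≡m n≤a+x)) (+-monoʳ-< a x<n))

shift<n : ∀ {n a x} → a ≤ n → x < n → shift n a x < n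
shift<n {n} {a} {x} a≤n x<n with n ≤? a + x
... | no  n≰a+x = subst (_< n) (sym (shift-no-wrap {a = a} (≰⇒> n≰a+x))) (≰⇒> n≰a+x)
... | yes n≤a+x = subst (_< n) (sym (shift-wrap {a = a} n≤a+x)) (<-≤-trans (wrapped-< x<n n≤a+x) a≤n)

shift-inverse : ∀ {n a b x} → a + b ≡ n → x < n → shift n b (shift n a x) ≡ x
shift-inverse {n} {a} {b} {x} a+b≡n x<n = by-cases (n ≤? a + x)
  where
  open ≡-Reasoning

  b+[a+x]≡n+x : b + (a + x) ≡ n + x
  b+[a+x]≡n+x = trans (sym (+-assoc b a x)) (cong (_+ x) (trans (+-comm b a) a+b≡n))

  by-cases : Dec (n ≤ a + x) → shift n b (shift n a x) ≡ x
  by-cases (no n≰a+x) = begin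
    shift n b (shift n a x)  ≡⟨ cong (shift n b) (shift-no-wrap {a = a} (≰⇒> n≰a+x)) ⟩
    shift n b (a + x)        ≡⟨ shift-wrap {a = b} (subst (n ≤_) (sym b+[a+x]≡n+x) (m≤m+n n x)) ⟩
    b + (a + x) ∸ n          ≡⟨ cong (_∸ n) b+[a+x]≡n+x ⟩
    n + x ∸ n                ≡⟨ m+n∸m≡n n x ⟩
    x                        ∎
  by-cases (yes n≤a+x) = begin
    shift n b (shift n a x)  ≡⟨ cong (shift n b) (shift-wrap {a = a} n≤a+x) ⟩
    shift n b (a + x ∸ n)    ≡⟨ shift-no-wrap {a = b} (subst (_< n) (sym b+[a+x∸n]≡x) x<n) ⟩
    b + (a + x ∸ n)          ≡⟨ b+[a+x∸n]≡x ⟩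
    x                        ∎
    where
    b+[a+x∸n]≡x : b + (a + x ∸ n) ≡ x
    b+[a+x∸n]≡x = begin
      b + (a + x ∸ n)  ≡⟨ +-∸-assoc b n≤a+x ⟨
      b + (a + x) ∸ n  ≡⟨ cong (_∸ n) b+[a+x]≡n+x ⟩
      n + x ∸ n        ≡⟨ m+n∸m≡n n x ⟩
      x                ∎

shift-<? : ∀ {n a x y} → x < n → y < n →
  does (shift n a x <? shift n a y) ≡ does (x <? y) xor (wraps n a x xor wraps n a y)
shift-<? {n} {a} {x} {y} x<n y<n with n ≤? a + x | n ≤? a + y
... | no n≰a+x | no n≰a+y
  rewrite shift-no-wrap {a = a} (≰⇒> n≰a+x) | shift-no-wrap {a = a} (≰⇒> n≰a+y)
        | dec-false (n ≤? a + x) n≰a+x | dec-false (n ≤? a + y) n≰a+y =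
  trans (sym (does-<?-cong {x} {y} (+-monoʳ-< a) (+-monoʳ-≤ a))) (sym (xor-identityʳ _))
... | yes n≤a+x | yes n≤a+y
  rewrite shift-wrap {a = a} n≤a+x | shift-wrap {a = a} n≤a+y
        | dec-true (n ≤? a + x) n≤a+x | dec-true (n ≤? a + y) n≤a+y =
  trans (sym (does-<?-cong {x} {y} (λ x<y → ∸-monoˡ-< (+-monoʳ-< a x<y) n≤a+x)
                                   (λ y≤x → ∸-monoˡ-≤ n (+-monoʳ-≤ a y≤x))))
        (sym (xor-identityʳ _))
... | no n≰a+x | yes n≤a+y
  rewrite shift-no-wrap {a = a} (≰⇒> n≰a+x) | shift-wrap {a = a} n≤a+y
        | dec-false (n ≤? a + x) n≰a+x | dec-true (n ≤? a + y) n≤a+y =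
  trans (dec-false (a + x <? a + y ∸ n) (<⇒≯ (<-≤-trans (wrapped-< y<n n≤a+y) (m≤m+n a x))))
        (sym (trans (xor-trueʳ _) (cong not (dec-true (x <? y) x<y))))
  where
  x<y : x < y
  x<y = +-cancelˡ-< a x y (<-≤-trans (≰⇒> n≰a+x) n≤a+y)
... | yes n≤a+x | no n≰a+y
  rewrite shift-wrap {a = a} n≤a+x | shift-no-wrap {a = a} (≰⇒> n≰a+y)
        | dec-true (n ≤? a + x) n≤a+x | dec-false (n ≤? a + y) n≰a+y =
  trans (dec-true (a + x ∸ n <? a + y) (<-≤-trans (wrapped-< x<n n≤a+x) (m≤m+n a y)))
        (sym (trans (xor-trueʳ _) (cong not (dec-false (x <? y) (<⇒≯ y<x)))))
  where
  y<x : y < x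
  y<x = +-cancelˡ-< a y x (<-≤-trans (≰⇒> n≰a+y) n≤a+x)

shiftᶠ : ∀ {n} a → a ≤ n → Fin n → Fin n
shiftᶠ a a≤n x = fromℕ< (shift<n a≤n (toℕ<n x))

shiftᶠ-inverse : ∀ {n a b} (a≤n : a ≤ n) (b≤n : b ≤ n) → a + b ≡ n →
  ∀ x → shiftᶠ b b≤n (shiftᶠ a a≤n x) ≡ x
shiftᶠ-inverse {n} {a} {b} a≤n b≤n a+b≡n x = toℕ-injective (begin
  toℕ (shiftᶠ b b≤n (shiftᶠ a a≤n x))  ≡⟨ toℕ-fromℕ< _ ⟩
  shift n b (toℕ (shiftᶠ a a≤n x))     ≡⟨ cong (shift n b) (toℕ-fromℕ< _) ⟩
  shift n b (shift n a (toℕ x))        ≡⟨ shift-inverse a+b≡n (toℕ<n x) ⟩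
  toℕ x                                ∎)
  where open ≡-Reasoning

rotate : ∀ {n} → Fin n → Permutation′ n
rotate {n} u = permutation (shiftᶠ a a≤n) (shiftᶠ (n ∸ a) n∸a≤n)
  (shiftᶠ-inverse n∸a≤n a≤n (trans (+-comm (n ∸ a) a) (m+[n∸m]≡n a≤n)))
  (shiftᶠ-inverse a≤n n∸a≤n (m+[n∸m]≡n a≤n))
  where
  a : ℕ
  a = toℕ u
  a≤n : a ≤ n
  a≤n = <⇒≤ (toℕ<n u)
  n∸a≤n : n ∸ a ≤ n
  n∸a≤n = m∸n≤m n a

wrapsAt : ∀ {n} → Fin n → Fin n → Bool
wrapsAt {n} u x = wraps n (toℕ u) (toℕ x)

toℕ-rotate : ∀ {n} (u x : Fin n) → toℕ (rotate u ⟨$⟩ʳ x) ≡ shift n (toℕ u) (toℕ x)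
toℕ-rotate u x = toℕ-fromℕ< _

rotate-zero : ∀ {m} (u : Fin (suc m)) → rotate u ⟨$⟩ʳ zero ≡ u
rotate-zero u = toℕ-injective (trans (toℕ-rotate u zero)
  (trans (shift-no-wrap {a = toℕ u} (subst (_< _) (sym (+-identityʳ (toℕ u))) (toℕ<n u)))
         (+-identityʳ (toℕ u))))

ascending-rotate : ∀ {n} (u x y : Fin n) →
  ascending (rotate u ⟨$⟩ʳ x) (rotate u ⟨$⟩ʳ y) ≡ ascending x y xor (wrapsAt u x xor wrapsAt u y)
ascending-rotate u x y rewrite toℕ-rotate u x | toℕ-rotate u y = shift-<? (toℕ<n x) (toℕ<n y)

-- Rotating reverses exactly the arcs between wrapped and unwrapped vertices, which the wrapsAt
-- term switches back; the final xor with c u only normalises the first letter to false.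
rotatedWord : ∀ {n} → Fin n → (Fin n → Bool) → Fin n → Bool
rotatedWord u c x = (wrapsAt u x xor c (rotate u ⟨$⟩ʳ x)) xor c u

rotatedWord-zero : ∀ {m} (u : Fin (suc m)) c → rotatedWord u c zero ≡ false
rotatedWord-zero {m} u c = begin
  (wrapsAt u zero xor c (rotate u ⟨$⟩ʳ zero)) xor c u
    ≡⟨ cong₂ (λ w v → (w xor c v) xor c u)
             (dec-false (suc m ≤? toℕ u + 0) (<⇒≱ u+0<n)) (rotate-zero u) ⟩
  c u xor c u
    ≡⟨ xor-same (c u) ⟩
  false ∎
  where
  open ≡-Reasoning
  u+0<n : toℕ u + 0 < suc m
  u+0<n = subst (_< suc m) (sym (+-identityʳ (toℕ u))) (toℕ<n u)

rotate-hom : ∀ {n} (u : Fin n) (c : Fin n → Bool) x y →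
  adj (switchedTransitive c) (rotate u ⟨$⟩ʳ x) (rotate u ⟨$⟩ʳ y)
    ≡ adj (switchedTransitive (rotatedWord u c)) x y
rotate-hom u c x y = begin
  ascending (rotate u ⟨$⟩ʳ x) (rotate u ⟨$⟩ʳ y) xor (c (rotate u ⟨$⟩ʳ x) xor c (rotate u ⟨$⟩ʳ y))
    ≡⟨ cong (_xor (c (rotate u ⟨$⟩ʳ x) xor c (rotate u ⟨$⟩ʳ y))) (ascending-rotate u x y) ⟩
  (ascending x y xor (wrapsAt u x xor wrapsAt u y)) xor (c (rotate u ⟨$⟩ʳ x) xor c (rotate u ⟨$⟩ʳ y))
    ≡⟨ solve 6 (λ l wx wy cx cy cu → (l :+ (wx :+ wy)) :+ (cx :+ cy)
                                    := l :+ (((wx :+ cx) :+ cu) :+ ((wy :+ cy) :+ cu)))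
         refl (ascending x y) (wrapsAt u x) (wrapsAt u y)
              (c (rotate u ⟨$⟩ʳ x)) (c (rotate u ⟨$⟩ʳ y)) (c u) ⟩
  adj (switchedTransitive (rotatedWord u c)) x y ∎
  where open ≡-Reasoning
        open xor-∧-Solver

wordAt-switchedTransitive : ∀ {m} (c : Fin (suc m) → Bool) u i →
  wordAt (switchedTransitive c) u i ≡ rotatedWord u c i
wordAt-switchedTransitive c u i = begin
  wordAt (switchedTransitive c) u i
    ≡⟨ cong (λ v → wordAt (switchedTransitive c) v i) (rotate-zero u) ⟨
  wordAt (switchedTransitive c) (rotate u ⟨$⟩ʳ zero) i
    ≡⟨ wordAt-iso (switchedTransitive (rotatedWord u c)) (switchedTransitive c)
                  (rotate u) (rotate-hom u c) zero i ⟩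
  wordAt (switchedTransitive (rotatedWord u c)) zero i
    ≡⟨ wordAt-zero (rotatedWord u c) (rotatedWord-zero u c) i ⟩
  rotatedWord u c i ∎
  where open ≡-Reasoning

-- Minimal codes

encode : ∀ {n} → (Fin n → Bool) → Fin (2 ^ n)
encode w = funToFin (Inverse.from 2↔Bool ∘ w)

decode : ∀ {n} → Fin (2 ^ n) → Fin n → Bool
decode x = Inverse.to 2↔Bool ∘ finToFun x

funToFin-cong : ∀ {m n} {f g : Fin m → Fin n} → (∀ i → f i ≡ g i) → funToFin f ≡ funToFin g
funToFin-cong {zero}  _   = refl
funToFin-cong {suc m} f≗g = cong₂ combine (f≗g zero) (funToFin-cong (f≗g ∘ suc))

encode-cong : ∀ {n} {w w′ : Fin n → Bool} → (∀ i → w i ≡ w′ i) → encode w ≡ encode w′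
encode-cong w≗w′ = funToFin-cong (cong (Inverse.from 2↔Bool) ∘ w≗w′)

decode-encode : ∀ {n} (w : Fin n → Bool) i → decode {n} (encode w) i ≡ w i
decode-encode w i =
  trans (cong (Inverse.to 2↔Bool) (finToFun-funToFin _ i)) (Inverse.strictlyInverseˡ 2↔Bool (w i))

decode-injective : ∀ {n} {x y : Fin (2 ^ n)} → (∀ i → decode {n} x i ≡ decode y i) → x ≡ y
decode-injective {n} {x} {y} x≈y = begin
  x                              ≡⟨ funToFin-finToFin {n} x ⟨
  funToFin (finToFun {2} {n} x)  ≡⟨ funToFin-cong (Injection.injective (↔⇒↣ 2↔Bool) ∘ x≈y) ⟩
  funToFin (finToFun {2} {n} y)  ≡⟨ funToFin-finToFin {n} y ⟩
  y                              ∎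
  where open ≡-Reasoning

minVertex : ∀ {m} → Tournament (suc m) → Fin (suc m)
minVertex {m} T = argmin (λ v → encode {suc m} (wordAt T v)) zero (allFin (suc m))
  where open Extrema (Finₚ.≤-totalOrder (2 ^ suc m))

minCode : ∀ {m} → Tournament (suc m) → Fin (2 ^ suc m)
minCode T = encode (wordAt T (minVertex T))

minCode-minimal : ∀ {m} (T : Tournament (suc m)) v → minCode T ≤ᶠ encode (wordAt T v)
minCode-minimal {m} T v =
  All.lookup (f[argmin]≤f[xs] {f = λ v → encode {suc m} (wordAt T v)} zero (allFin (suc m))) (∈-allFin v)
  where open Extrema (Finₚ.≤-totalOrder (2 ^ suc m))

decode-minCode : ∀ {m} (T : Tournament (suc m)) i → decode {suc m} (minCode T) i ≡ wordAt T (minVertex T) i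
decode-minCode T = decode-encode (wordAt T (minVertex T))

iso-sym : ∀ {n} {S T : Tournament n} → Iso S T → Iso T S
iso-sym {T = T} (π , π-hom) = flip π , λ u v →
  trans (sym (π-hom (π ⟨$⟩ˡ u) (π ⟨$⟩ˡ v))) (cong₂ (adj T) (inverseʳ π) (inverseʳ π))

minCode-≤ : ∀ {m} (S T : Tournament (suc m)) → Iso S T → minCode T ≤ᶠ minCode S
minCode-≤ S T (π , π-hom) = Finₚ.≤-trans (minCode-minimal T (π ⟨$⟩ʳ minVertex S))
  (Finₚ.≤-reflexive (encode-cong (wordAt-iso S T π π-hom (minVertex S))))

minCode-iso : ∀ {m} (S T : Tournament (suc m)) → Iso S T → minCode S ≡ minCode T
minCode-iso S T iso = Finₚ.≤-antisym (minCode-≤ T S (iso-sym {S = S} {T} iso)) (minCode-≤ S T iso)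

rotate-minVertex-hom : ∀ {m} (c : Fin (suc m) → Bool) x y →
  adj (switchedTransitive c) (rotate (minVertex (switchedTransitive c)) ⟨$⟩ʳ x)
                             (rotate (minVertex (switchedTransitive c)) ⟨$⟩ʳ y)
    ≡ adj (switchedTransitive (decode {suc m} (minCode (switchedTransitive c)))) x y
rotate-minVertex-hom c x y = trans (rotate-hom (minVertex (switchedTransitive c)) c x y)
  (switchedTransitive-cong (λ i → sym (trans (decode-minCode (switchedTransitive c) i)
                                             (wordAt-switchedTransitive c (minVertex (switchedTransitive c)) i))) x y)

minCode-idempotent : ∀ {m} (c : Fin (suc m) → Bool) →
  minCode (switchedTransitive (decode {suc m} (minCode (switchedTransitive c)))) ≡ minCode (switchedTransitive c)
minCode-idempotent {m} c =
  minCode-iso (switchedTransitive (decode {suc m} (minCode (switchedTransitive c)))) (switchedTransitive c)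
    (rotate (minVertex (switchedTransitive c)) , rotate-minVertex-hom c)

recover-word : ∀ {m} (c : Fin (suc m) → Bool) → c zero ≡ false →
  ∀ {x u} → minCode (switchedTransitive c) ≡ x → minVertex (switchedTransitive c) ≡ u →
  ∀ i → c i ≡ wordAt (switchedTransitive (decode {suc m} x)) (rotate u ⟨$⟩ˡ zero) i
recover-word {m} c c₀≡f refl refl i =
  trans (sym (wordAt-zero c c₀≡f i))
  (trans (cong (λ v → wordAt (switchedTransitive c) v i)
               (sym (inverseʳ (rotate (minVertex (switchedTransitive c))))))
         (wordAt-iso (switchedTransitive (decode {suc m} (minCode (switchedTransitive c)))) (switchedTransitive c)
                     (rotate (minVertex (switchedTransitive c))) (rotate-minVertex-hom c)
                     (rotate (minVertex (switchedTransitive c)) ⟨$⟩ˡ zero) i))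

-- Counting isomorphism classes

lookup-injective : ∀ {a} {A : Set a} {xs : List A} → Unique xs →
  ∀ {i j} → lookup xs i ≡ lookup xs j → i ≡ j
lookup-injective {xs = _ ∷ _} (_  ∷ _)   {zero}  {zero}  _  = refl
lookup-injective {xs = _ ∷ _} (x∉ ∷ _)   {zero}  {suc j} eq = ⊥-elim (All.lookup x∉ (∈-lookup j) eq)
lookup-injective {xs = _ ∷ _} (x∉ ∷ _)   {suc i} {zero}  eq = ⊥-elim (All.lookup x∉ (∈-lookup i) (sym eq))
lookup-injective {xs = _ ∷ _} (_  ∷ xs!) {suc i} {suc j} eq = cong suc (lookup-injective xs! eq)

module Census (m : ℕ) where

  Canonical : Fin (2 ^ suc m) → Set
  Canonical x = minCode (switchedTransitive (decode {suc m} x)) ≡ x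

  canonical? : Decidable Canonical
  canonical? x = minCode (switchedTransitive (decode {suc m} x)) Finₚ.≟ x

  canonicalCodes : List (Fin (2 ^ suc m))
  canonicalCodes = filter canonical? (allFin (2 ^ suc m))

  classes : ℕ
  classes = length canonicalCodes

  representative : Fin classes → Tournament (suc m)
  representative t = switchedTransitive (decode {suc m} (lookup canonicalCodes t))

  representative-realizable : ∀ t → Realizable I100 (representative t)
  representative-realizable t = switchedTransitive-realizable (decode {suc m} (lookup canonicalCodes t))

  representative-canonical : ∀ t → Canonical (lookup canonicalCodes t)
  representative-canonical t =
    proj₂ (∈-filter⁻ canonical? {xs = allFin (2 ^ suc m)} (∈-lookup {xs = canonicalCodes} t))

  representatives-nonIso : ∀ s t → ¬ s ≡ t → ¬ Iso (representative s) (representative t)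
  representatives-nonIso s t s≢t iso =
    s≢t (lookup-injective (Uniqueₚ.filter⁺ canonical? (Uniqueₚ.allFin⁺ (2 ^ suc m))) (begin
      lookup canonicalCodes s     ≡⟨ representative-canonical s ⟨
      minCode (representative s)  ≡⟨ minCode-iso (representative s) (representative t) iso ⟩
      minCode (representative t)  ≡⟨ representative-canonical t ⟩
      lookup canonicalCodes t     ∎))
    where open ≡-Reasoning

  word : Fin (2 ^ m) → Fin (suc m) → Bool
  word y zero    = false
  word y (suc i) = decode y i

  code∈canonicalCodes : ∀ y → minCode (switchedTransitive (word y)) ∈ canonicalCodes
  code∈canonicalCodes y =
    ∈-filter⁺ canonical? {xs = allFin (2 ^ suc m)} (∈-allFin _) (minCode-idempotent (word y))

  classOf : Fin (2 ^ m) → Fin classes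
  classOf y = Any.index (code∈canonicalCodes y)

  signature : Fin (2 ^ m) → Fin (classes * suc m)
  signature y = combine (classOf y) (minVertex (switchedTransitive (word y)))

  signature-injective : Injective _≡_ _≡_ signature
  signature-injective {y} {y′} eq = decode-injective {m} λ i →
    trans (recover-word (word y) refl {code} {vertex} (AnyP.lookup-index (code∈canonicalCodes y)) refl (suc i))
          (sym (recover-word (word y′) refl {code} {vertex} code′≡code (sym same-vertex) (suc i)))
    where
    code : Fin (2 ^ suc m)
    code = lookup canonicalCodes (classOf y)

    vertex : Fin (suc m)
    vertex = minVertex (switchedTransitive (word y))

    same-class×same-vertex : classOf y ≡ classOf y′ × vertex ≡ minVertex (switchedTransitive (word y′))
    same-class×same-vertex = Finₚ.combine-injective _ _ _ _ eq

    same-vertex : vertex ≡ minVertex (switchedTransitive (word y′))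
    same-vertex = proj₂ same-class×same-vertex

    code′≡code : minCode (switchedTransitive (word y′)) ≡ code
    code′≡code = trans (AnyP.lookup-index (code∈canonicalCodes y′))
                       (cong (lookup canonicalCodes) (sym (proj₁ same-class×same-vertex)))

  classes-bound : 2 ^ m ≤ suc m * classes
  classes-bound =
    subst (2 ^ m ≤_) (*-comm classes (suc m)) (Finₚ.injective⇒≤ {f = signature} signature-injective)

lemma17 : (n : ℕ) → 1 ≤ n →
    ∃[ k ] (2 ^ (n ∸ 1) ≤ n * k ×
      Σ (Fin k → Tournament n) λ Ts → ((∀ (t : Fin k) → Realizable I100 (Ts t)) ×
        (∀ (s t : Fin k) → ¬ (s ≡ t) → ¬ Iso {n} (Ts s) (Ts t))))
lemma17 (suc m) _ =
  classes , classes-bound , representative , representative-realizable , representatives-nonIso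
  where open Census m
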